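{- For any $r\ge s\ge 1$, $\mu^-(K_{r,s})=s+1$ and $\operatorname{gp}^-(K_{r,s})=2$.
   Context: For a graph $G$ and $X\subseteq V(G)$, two vertices $u,v$ are $X$-visible if there is a shortest $u,v$-path whose internal vertices are not in $X$; $X$ is a mutual-visibility set if every two vertices of $X$ are $X$-visible. $\mu^-(G)$ is the smallest cardinality of a maximal (by inclusion) mutual-visibility set. A general position set is a set $X$ such that for every $u,v\in X$, no shortest $u,v$-path contains a third vertex of $X$; $\operatorname{gp}^-(G)$ (lower general position number) is the smallest cardinality of a maximal general position set. -}

module Defs where

open import Data.Nat using (ℕ; zero; suc; _+_; _≤_; _<_)
open import Data.Fin using (Fin; toℕ)
open import Data.Fin.Subset using (Subset; _∈_; _∉_; _⊆_; ∣_∣)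
open import Data.List using (List; []; _∷_)
import Data.List.Membership.Propositional as LM
open import Data.Product using (Σ; ∃; _×_; _,_)
open import Data.Sum using (_⊎_)
open import Relation.Binary.PropositionalEquality using (_≡_)
open import Relation.Nullary using (¬_)

record Graph : Set₁ where
  field
    n   : ℕ
    Adj : Fin n → Fin n → Set

module _ (G : Graph) where
  open Graph G

  data Walk : Fin n → Fin n → Set where
    []  : ∀ {u} → Walk u u
    _∷_ : ∀ {u w v} → Adj u w → Walk w v → Walk u v

  len : ∀ {u v} → Walk u v → ℕ
  len []      = 0
  len (_ ∷ p) = suc (len p)

  support : ∀ {u v} → Walk u v → List (Fin n)
  support {u} []      = u ∷ []
  support {u} (_ ∷ p) = u ∷ support p

  interior : ∀ {u v} → Walk u v → List (Fin n)
  interior []                      = []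
  interior (_ ∷ [])                = []
  interior (_∷_ {w = w} _ (e ∷ p)) = w ∷ interior (e ∷ p)

  -- a shortest u,v-path: a u,v-walk of minimum length (such walks are paths)
  IsShortest : ∀ {u v} → Walk u v → Set
  IsShortest {u} {v} p = ∀ (q : Walk u v) → len p ≤ len q

  Visible : Subset n → Fin n → Fin n → Set
  Visible X u v = Σ (Walk u v) λ p → IsShortest p ×
                    (∀ x → x LM.∈ interior p → x ∉ X)

  IsMutualVisibility : Subset n → Set
  IsMutualVisibility X = ∀ u v → u ∈ X → v ∈ X → Visible X u v

  IsMaximalMutualVisibility : Subset n → Set
  IsMaximalMutualVisibility X =
    IsMutualVisibility X × (∀ Y → IsMutualVisibility Y → X ⊆ Y → Y ⊆ X)

  IsGeneralPosition : Subset n → Set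
  IsGeneralPosition X = ∀ u v → u ∈ X → v ∈ X → (p : Walk u v) → IsShortest p →
    ∀ w → w ∈ X → ¬ (w ≡ u) → ¬ (w ≡ v) → ¬ (w LM.∈ support p)

  IsMaximalGeneralPosition : Subset n → Set
  IsMaximalGeneralPosition X =
    IsGeneralPosition X × (∀ Y → IsGeneralPosition Y → X ⊆ Y → Y ⊆ X)

IsMinCard : ∀ {n} → (Subset n → Set) → ℕ → Set
IsMinCard P k = (∃ λ X → P X × ∣ X ∣ ≡ k) × (∀ X → P X → k ≤ ∣ X ∣)

MuMinusIs : (G : Graph) → ℕ → Set
MuMinusIs G k = IsMinCard (IsMaximalMutualVisibility G) k

GpMinusIs : (G : Graph) → ℕ → Set
GpMinusIs G k = IsMinCard (IsMaximalGeneralPosition G) k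

-- complete bipartite graph K_{r,s}: vertices Fin (r + s);
-- part A = {i | toℕ i < r} (size r), part B = the remaining s vertices
K : ℕ → ℕ → Graph
K r s = record
  { n   = r + s
  ; Adj = λ i j → (toℕ i < r × r ≤ toℕ j) ⊎ (r ≤ toℕ i × toℕ j < r)
  }

-- Two distinct vertices on the same side of K_{r,s} are at distance two, and
-- their shortest paths pass through a single vertex of the other side. So a set
-- P ∪ Q (P ⊆ A, Q ⊆ B) is mutual-visibility iff two vertices in P force a vertex
-- of B outside Q and two vertices in Q force a vertex of A outside P. Hence the
-- closed neighbourhood {a} ∪ B of a ∈ A is a maximal mutual-visibility set of
-- size s + 1. If a maximal X had at most s vertices, counting shows that X ∪ {b}
-- is still mutual-visibility for every b ∈ B; so B ⊆ X, the count leaves no room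
-- for a vertex of A, and X = B ⊊ {a} ∪ B contradicts maximality.
--
-- Every set of at most two vertices is in general position, so in any graph on
-- at least two vertices maximal general position sets have two elements or more.
-- The set {a, b} with a ∈ A, b ∈ B is maximal: a third vertex x is at distance
-- two from a or from b, with the other one in the middle of a shortest path.
module Submission where

open import Defs
open import Data.Nat using (ℕ; suc; _+_; _≤_; _<_; z≤n; s≤s)
open import Data.Nat.Properties
  using (≤-refl; m≤m+n; ≤-reflexive; n≤1+n; ≤-pred; ≤-trans; +-mono-≤; +-comm; <⇒≱; ≰⇒>; ≮⇒≥)
open import Data.Bool using (true; false)
open import Data.Fin using (Fin; zero; suc; toℕ; _↑ˡ_; _↑ʳ_; fromℕ<; splitAt)
open import Data.Fin.Properties
  using (_≟_; ↑ˡ-injective; ↑ʳ-injective; splitAt⁻¹-↑ˡ; splitAt⁻¹-↑ʳ; toℕ-↑ˡ; toℕ-↑ʳ;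
         toℕ<n; ¬∀⟶∃¬)
open import Data.Fin.Subset using (Subset; _∈_; _∉_; _⊆_; ∣_∣; ⊤; ⁅_⁆; _∪_)
open import Data.Fin.Subset.Properties
  using (_∈?_; ∈⊤; ∣⊤∣≡n; ∣⁅x⁆∣≡1; x∈⁅x⁆; x∈⁅y⁆⇒x≡y; p⊆q⇒∣p∣≤∣q∣; p⊆p∪q; q⊆p∪q;
         x∈p⇒∣p-x∣<∣p∣; x∈p∧x≢y⇒x∈p-y; ∪-identityʳ)
open import Data.Vec.Base using ([]; _∷_; _++_; here; there)
import Data.Vec.Base as Vec
open import Data.List.Relation.Unary.Any as Any using ()
import Data.List.Membership.Propositional as List
open import Data.Product using (∃; _×_; _,_)
open import Data.Sum using (inj₁; inj₂)
open import Data.Empty using (⊥-elim)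
open import Function using (_∘_)
open import Relation.Binary.PropositionalEquality
  using (_≡_; _≢_; refl; sym; trans; cong; cong₂; subst; ≢-sym)
open import Relation.Nullary using (¬_; yes; no)

module _ {n : ℕ} where

  ∀∈⇒n≤∣p∣ : {p : Subset n} → (∀ x → x ∈ p) → n ≤ ∣ p ∣
  ∀∈⇒n≤∣p∣ {p} all∈p = subst (_≤ ∣ p ∣) (∣⊤∣≡n n) (p⊆q⇒∣p∣≤∣q∣ {p = ⊤} (λ {x} _ → all∈p x))

  ¬∀∈⇒∃∉ : {p : Subset n} → ¬ (∀ x → x ∈ p) → ∃ λ x → x ∉ p
  ¬∀∈⇒∃∉ {p} = ¬∀⟶∃¬ n (_∈ p) (_∈? p)

  x∈p⇒1≤∣p∣ : {p : Subset n} {x : Fin n} → x ∈ p → 1 ≤ ∣ p ∣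
  x∈p⇒1≤∣p∣ x∈p = ≤-trans (s≤s z≤n) (x∈p⇒∣p-x∣<∣p∣ x∈p)

  x≢y⇒2≤∣p∣ : {p : Subset n} {x y : Fin n} → x ≢ y → x ∈ p → y ∈ p → 2 ≤ ∣ p ∣
  x≢y⇒2≤∣p∣ x≢y x∈p y∈p =
    ≤-trans (s≤s (x∈p⇒1≤∣p∣ (x∈p∧x≢y⇒x∈p-y y∈p (≢-sym x≢y)))) (x∈p⇒∣p-x∣<∣p∣ x∈p)

  x≢y≢z⇒3≤∣p∣ : {p : Subset n} {x y z : Fin n} → x ≢ y → x ≢ z → y ≢ z →
                x ∈ p → y ∈ p → z ∈ p → 3 ≤ ∣ p ∣
  x≢y≢z⇒3≤∣p∣ x≢y x≢z y≢z x∈p y∈p z∈p =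
    ≤-trans (s≤s (x≢y⇒2≤∣p∣ y≢z (x∈p∧x≢y⇒x∈p-y y∈p (≢-sym x≢y))
                                (x∈p∧x≢y⇒x∈p-y z∈p (≢-sym x≢z))))
            (x∈p⇒∣p-x∣<∣p∣ x∈p)

  x≢y⇒2≤n : {x y : Fin n} → x ≢ y → 2 ≤ n
  x≢y⇒2≤n x≢y = subst (2 ≤_) (∣⊤∣≡n n) (x≢y⇒2≤∣p∣ x≢y ∈⊤ ∈⊤)

∣p∪⁅x⁆∣≤1+∣p∣ : ∀ {n} (p : Subset n) (x : Fin n) → ∣ p ∪ ⁅ x ⁆ ∣ ≤ suc ∣ p ∣
∣p∪⁅x⁆∣≤1+∣p∣ (false ∷ p) zero    = s≤s (≤-reflexive (cong ∣_∣ (∪-identityʳ p)))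
∣p∪⁅x⁆∣≤1+∣p∣ (true  ∷ p) zero    = s≤s (≤-trans (≤-reflexive (cong ∣_∣ (∪-identityʳ p)))
                                                   (n≤1+n ∣ p ∣))
∣p∪⁅x⁆∣≤1+∣p∣ (false ∷ p) (suc x) = ∣p∪⁅x⁆∣≤1+∣p∣ p x
∣p∪⁅x⁆∣≤1+∣p∣ (true  ∷ p) (suc x) = s≤s (∣p∪⁅x⁆∣≤1+∣p∣ p x)

∈-++⁺ˡ : ∀ {m n} {p : Subset m} {q : Subset n} {i} → i ∈ p → i ↑ˡ n ∈ p ++ q
∈-++⁺ˡ here      = here
∈-++⁺ˡ (there h) = there (∈-++⁺ˡ h)

∈-++⁺ʳ : ∀ {m n} (p : Subset m) {q : Subset n} {j} → j ∈ q → m ↑ʳ j ∈ p ++ q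
∈-++⁺ʳ []      h = h
∈-++⁺ʳ (_ ∷ p) h = there (∈-++⁺ʳ p h)

∈-++⁻ˡ : ∀ {m n} {p : Subset m} {q : Subset n} i → i ↑ˡ n ∈ p ++ q → i ∈ p
∈-++⁻ˡ {p = _ ∷ _} zero    here      = here
∈-++⁻ˡ {p = _ ∷ _} (suc i) (there h) = there (∈-++⁻ˡ i h)

∈-++⁻ʳ : ∀ {m n} (p : Subset m) {q : Subset n} {j} → m ↑ʳ j ∈ p ++ q → j ∈ q
∈-++⁻ʳ []      h         = h
∈-++⁻ʳ (_ ∷ p) (there h) = ∈-++⁻ʳ p h

∣p++q∣≡∣p∣+∣q∣ : ∀ {m n} (p : Subset m) (q : Subset n) → ∣ p ++ q ∣ ≡ ∣ p ∣ + ∣ q ∣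
∣p++q∣≡∣p∣+∣q∣ []          q = refl
∣p++q∣≡∣p∣+∣q∣ (true  ∷ p) q = cong suc (∣p++q∣≡∣p∣+∣q∣ p q)
∣p++q∣≡∣p∣+∣q∣ (false ∷ p) q = ∣p++q∣≡∣p∣+∣q∣ p q

data Split (m n : ℕ) : Fin (m + n) → Set where
  inˡ : (i : Fin m) → Split m n (i ↑ˡ n)
  inʳ : (j : Fin n) → Split m n (m ↑ʳ j)

split : ∀ m {n} (i : Fin (m + n)) → Split m n i
split m i with splitAt m i in eq
... | inj₁ j = subst (Split m _) (splitAt⁻¹-↑ˡ eq) (inˡ j)
... | inj₂ k = subst (Split m _) (splitAt⁻¹-↑ʳ eq) (inʳ k)

++-mono-⊆ : ∀ {m n} {p p′ : Subset m} {q q′ : Subset n} →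
            p ⊆ p′ → q ⊆ q′ → p ++ q ⊆ p′ ++ q′
++-mono-⊆ {m} {p = p} {p′} p⊆p′ q⊆q′ {x} x∈p++q with split m x
... | inˡ i = ∈-++⁺ˡ (p⊆p′ (∈-++⁻ˡ i x∈p++q))
... | inʳ j = ∈-++⁺ʳ p′ (q⊆q′ (∈-++⁻ʳ p x∈p++q))

module _ (G : Graph) where
  open Graph G

  edge-shortest : ∀ {u v} → u ≢ v → (e : Adj u v) → IsShortest G (e ∷ [])
  edge-shortest u≢v e []      = ⊥-elim (u≢v refl)
  edge-shortest u≢v e (_ ∷ _) = s≤s z≤n

  twoStep-shortest : ∀ {u w v} → u ≢ v → ¬ Adj u v → (e : Adj u w) (f : Adj w v) →
                     IsShortest G (e ∷ f ∷ [])
  twoStep-shortest u≢v ¬uv e f []          = ⊥-elim (u≢v refl)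
  twoStep-shortest u≢v ¬uv e f (g ∷ [])    = ⊥-elim (¬uv g)
  twoStep-shortest u≢v ¬uv e f (_ ∷ _ ∷ _) = s≤s (s≤s z≤n)

  visible-refl : ∀ X u → Visible G X u u
  visible-refl X u = [] , (λ _ → z≤n) , λ _ ()

  visible-edge : ∀ X {u v} → u ≢ v → Adj u v → Visible G X u v
  visible-edge X u≢v e = e ∷ [] , edge-shortest u≢v e , λ _ ()

  visible-through : ∀ X {u w v} → u ≢ v → ¬ Adj u v → Adj u w → Adj w v → w ∉ X →
                    Visible G X u v
  visible-through X u≢v ¬uv e f w∉X =
    e ∷ f ∷ [] , twoStep-shortest u≢v ¬uv e f , λ { _ (Any.here refl) → w∉X }

  neighbours⊆⇒¬visible : ∀ X {u w v} → u ≢ v → ¬ Adj u v → Adj u w → Adj w v →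
                         (∀ {x} → Adj u x → x ∈ X) → ¬ Visible G X u v
  neighbours⊆⇒¬visible X {u} {v = v} u≢v ¬uv e f N⊆X (p , p-shortest , p-avoids) =
    avoid p (p-shortest (e ∷ f ∷ [])) p-avoids
    where
    avoid : (p : Walk G u v) → len G p ≤ 2 →
            ¬ (∀ x → x List.∈ interior G p → x ∉ X)
    avoid []              _              _      = u≢v refl
    avoid (g ∷ [])        _              _      = ¬uv g
    avoid (g ∷ _ ∷ [])    _              avoids = avoids _ (Any.here refl) (N⊆X g)
    avoid (_ ∷ _ ∷ _ ∷ _) (s≤s (s≤s ())) _

  shortest-loop-support : ∀ {u} (p : Walk G u u) → IsShortest G p →
                          ∀ {w} → w List.∈ support G p → w ≡ u
  shortest-loop-support []      _          (Any.here w≡u) = w≡u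
  shortest-loop-support (_ ∷ _) p-shortest _ with p-shortest []
  ... | ()

  ∣X∣≤2⇒generalPosition : ∀ X → ∣ X ∣ ≤ 2 → IsGeneralPosition G X
  ∣X∣≤2⇒generalPosition X ∣X∣≤2 u v u∈X v∈X p p-shortest w w∈X w≢u w≢v w∈p with u ≟ v
  ... | yes refl = w≢u (shortest-loop-support p p-shortest w∈p)
  ... | no u≢v   = <⇒≱ (x≢y≢z⇒3≤∣p∣ u≢v (≢-sym w≢u) (≢-sym w≢v) u∈X v∈X w∈X) ∣X∣≤2

  twoStep⇒¬generalPosition : ∀ X {u w v} → u ≢ v → ¬ Adj u v → Adj u w → Adj w v →
                             w ≢ u → w ≢ v → u ∈ X → v ∈ X → w ∈ X →
                             ¬ IsGeneralPosition G X
  twoStep⇒¬generalPosition X u≢v ¬uv e f w≢u w≢v u∈X v∈X w∈X gp =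
    gp _ _ u∈X v∈X (e ∷ f ∷ []) (twoStep-shortest u≢v ¬uv e f) _ w∈X w≢u w≢v
       (Any.there (Any.here refl))

  maximalGeneralPosition⇒2≤∣X∣ : 2 ≤ n → ∀ X → IsMaximalGeneralPosition G X → 2 ≤ ∣ X ∣
  maximalGeneralPosition⇒2≤∣X∣ 2≤n X (_ , maximal) = ≮⇒≥ λ ∣X∣<2 →
    <⇒≱ 2≤n (≤-trans (∀∈⇒n≤∣p∣ (everywhere ∣X∣<2)) (≤-pred ∣X∣<2))
    where
    everywhere : ∣ X ∣ < 2 → ∀ z → z ∈ X
    everywhere ∣X∣<2 z =
      maximal (X ∪ ⁅ z ⁆)
        (∣X∣≤2⇒generalPosition _ (≤-trans (∣p∪⁅x⁆∣≤1+∣p∣ X z) ∣X∣<2))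
        (p⊆p∪q ⁅ z ⁆) (q⊆p∪q X ⁅ z ⁆ (x∈⁅x⁆ z))

module CompleteBipartite (r s : ℕ) where
  open Graph (K r s) using (Adj)

  A : Fin r → Fin (r + s)
  A j = j ↑ˡ s

  B : Fin s → Fin (r + s)
  B k = r ↑ʳ k

  A-injective : ∀ {j j′} → A j ≡ A j′ → j ≡ j′
  A-injective = ↑ˡ-injective s _ _

  B-injective : ∀ {k k′} → B k ≡ B k′ → k ≡ k′
  B-injective = ↑ʳ-injective r _ _

  toℕ-A<r : ∀ j → toℕ (A j) < r
  toℕ-A<r j = subst (_< r) (sym (toℕ-↑ˡ j s)) (toℕ<n j)

  r≤toℕ-B : ∀ k → r ≤ toℕ (B k)
  r≤toℕ-B k = subst (r ≤_) (sym (toℕ-↑ʳ r k)) (m≤m+n r (toℕ k))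

  A≢B : ∀ {j k} → A j ≢ B k
  A≢B {j} {k} Aj≡Bk = <⇒≱ (toℕ-A<r j) (subst (λ v → r ≤ toℕ v) (sym Aj≡Bk) (r≤toℕ-B k))

  A-adj-B : ∀ {j k} → Adj (A j) (B k)
  A-adj-B {j} {k} = inj₁ (toℕ-A<r j , r≤toℕ-B k)

  B-adj-A : ∀ {k j} → Adj (B k) (A j)
  B-adj-A {k} {j} = inj₂ (r≤toℕ-B k , toℕ-A<r j)

  ¬A-adj-A : ∀ {j j′} → ¬ Adj (A j) (A j′)
  ¬A-adj-A {j′ = j′} (inj₁ (_ , r≤j′)) = <⇒≱ (toℕ-A<r j′) r≤j′
  ¬A-adj-A {j}       (inj₂ (r≤j , _))  = <⇒≱ (toℕ-A<r j) r≤j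

  ¬B-adj-B : ∀ {k k′} → ¬ Adj (B k) (B k′)
  ¬B-adj-B {k}       (inj₁ (k<r , _))  = <⇒≱ k<r (r≤toℕ-B k)
  ¬B-adj-B {k′ = k′} (inj₂ (_ , k′<r)) = <⇒≱ k′<r (r≤toℕ-B k′)

  mutualVisibility-criterion :
    ∀ (P : Subset r) (Q : Subset s) →
    (∀ {j j′} → j ≢ j′ → j ∈ P → j′ ∈ P → ∃ λ k → k ∉ Q) →
    (∀ {k k′} → k ≢ k′ → k ∈ Q → k′ ∈ Q → ∃ λ j → j ∉ P) →
    IsMutualVisibility (K r s) (P ++ Q)
  mutualVisibility-criterion P Q missB missA u v u∈ v∈ with split r u | split r v
  ... | inˡ j | inʳ k = visible-edge (K r s) _ A≢B A-adj-B
  ... | inʳ k | inˡ j = visible-edge (K r s) _ (A≢B ∘ sym) B-adj-A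
  ... | inˡ j | inˡ j′ with j ≟ j′
  ...   | yes refl = visible-refl (K r s) _ _
  ...   | no j≢j′ with missB j≢j′ (∈-++⁻ˡ j u∈) (∈-++⁻ˡ j′ v∈)
  ...     | k , k∉Q = visible-through (K r s) _ (j≢j′ ∘ A-injective) ¬A-adj-A A-adj-B B-adj-A
                        (k∉Q ∘ ∈-++⁻ʳ P)
  mutualVisibility-criterion P Q missB missA u v u∈ v∈ | inʳ k | inʳ k′ with k ≟ k′
  ...   | yes refl = visible-refl (K r s) _ _
  ...   | no k≢k′ with missA k≢k′ (∈-++⁻ʳ P u∈) (∈-++⁻ʳ P v∈)
  ...     | j , j∉P = visible-through (K r s) _ (k≢k′ ∘ B-injective) ¬B-adj-B B-adj-A A-adj-B
                        (j∉P ∘ ∈-++⁻ˡ j)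

  module _ (1≤s : 1 ≤ s) (s≤r : s ≤ r) where

    a₀ : Fin r
    a₀ = fromℕ< (≤-trans 1≤s s≤r)

    b₀ : Fin s
    b₀ = fromℕ< 1≤s

    N[a₀] : Subset (r + s)
    N[a₀] = ⁅ a₀ ⁆ ++ ⊤

    a₀∈N[a₀] : A a₀ ∈ N[a₀]
    a₀∈N[a₀] = ∈-++⁺ˡ (x∈⁅x⁆ a₀)

    ∣N[a₀]∣≡1+s : ∣ N[a₀] ∣ ≡ suc s
    ∣N[a₀]∣≡1+s = trans (∣p++q∣≡∣p∣+∣q∣ ⁅ a₀ ⁆ ⊤) (cong₂ _+_ (∣⁅x⁆∣≡1 a₀) (∣⊤∣≡n s))

    N[a₀]-mutualVisibility : IsMutualVisibility (K r s) N[a₀]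
    N[a₀]-mutualVisibility = mutualVisibility-criterion ⁅ a₀ ⁆ ⊤ missB missA
      where
      missB : ∀ {j j′} → j ≢ j′ → j ∈ ⁅ a₀ ⁆ → j′ ∈ ⁅ a₀ ⁆ → ∃ λ k → k ∉ ⊤
      missB j≢j′ j∈ j′∈ = ⊥-elim (j≢j′ (trans (x∈⁅y⁆⇒x≡y a₀ j∈) (sym (x∈⁅y⁆⇒x≡y a₀ j′∈))))
      missA : ∀ {k k′} → k ≢ k′ → k ∈ ⊤ → k′ ∈ ⊤ → ∃ λ j → j ∉ ⁅ a₀ ⁆
      missA k≢k′ _ _ = ¬∀∈⇒∃∉ λ all∈ →
        <⇒≱ (≤-trans (x≢y⇒2≤n k≢k′) s≤r)
            (≤-trans (∀∈⇒n≤∣p∣ all∈) (≤-reflexive (∣⁅x⁆∣≡1 a₀)))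

    N[a₀]-maximal : ∀ Y → IsMutualVisibility (K r s) Y → N[a₀] ⊆ Y → Y ⊆ N[a₀]
    N[a₀]-maximal Y Y-visible N⊆Y {y} y∈Y with split r y
    ... | inʳ k = ∈-++⁺ʳ ⁅ a₀ ⁆ ∈⊤
    ... | inˡ j with j ≟ a₀
    ...   | yes refl = a₀∈N[a₀]
    ...   | no j≢a₀  = ⊥-elim (neighbours⊆⇒¬visible (K r s) Y (j≢a₀ ∘ A-injective ∘ sym)
                                 ¬A-adj-A (A-adj-B {k = b₀}) B-adj-A neighbours⊆Y
                                 (Y-visible _ _ (N⊆Y a₀∈N[a₀]) y∈Y))
      where
      neighbours⊆Y : ∀ {x} → Adj (A a₀) x → x ∈ Y
      neighbours⊆Y {x} e with split r x
      ... | inˡ _ = ⊥-elim (¬A-adj-A e)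
      ... | inʳ _ = N⊆Y (∈-++⁺ʳ ⁅ a₀ ⁆ ∈⊤)

    ∣P∣+∣Q∣≤s⇒mutualVisibility-∪⁅k⁆ : ∀ (P : Subset r) (Q : Subset s) k → ∣ P ∣ + ∣ Q ∣ ≤ s →
                                     IsMutualVisibility (K r s) (P ++ (Q ∪ ⁅ k ⁆))
    ∣P∣+∣Q∣≤s⇒mutualVisibility-∪⁅k⁆ P Q k small =
      mutualVisibility-criterion P (Q ∪ ⁅ k ⁆) missB missA
      where
      missB : ∀ {j j′} → j ≢ j′ → j ∈ P → j′ ∈ P → ∃ λ k′ → k′ ∉ Q ∪ ⁅ k ⁆
      missB j≢j′ j∈P j′∈P = ¬∀∈⇒∃∉ λ all∈ → <⇒≱
        (≤-trans (s≤s (≤-trans (∀∈⇒n≤∣p∣ all∈) (∣p∪⁅x⁆∣≤1+∣p∣ Q k)))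
                 (+-mono-≤ (x≢y⇒2≤∣p∣ j≢j′ j∈P j′∈P) ≤-refl))
        small
      -- Two distinct elements of Q ∪ ⁅ k ⁆ force Q to be nonempty.
      missA : ∀ {k₁ k₂} → k₁ ≢ k₂ → k₁ ∈ Q ∪ ⁅ k ⁆ → k₂ ∈ Q ∪ ⁅ k ⁆ → ∃ λ j → j ∉ P
      missA k₁≢k₂ k₁∈ k₂∈ = ¬∀∈⇒∃∉ λ all∈ → <⇒≱
        (≤-trans (s≤s s≤r)
          (≤-trans (≤-reflexive (+-comm 1 r))
            (+-mono-≤ (∀∈⇒n≤∣p∣ all∈)
                      (≤-pred (≤-trans (x≢y⇒2≤∣p∣ k₁≢k₂ k₁∈ k₂∈) (∣p∪⁅x⁆∣≤1+∣p∣ Q k))))))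
        small

    μ-lowerBound : ∀ X → IsMaximalMutualVisibility (K r s) X → suc s ≤ ∣ X ∣
    μ-lowerBound X (_ , maximal) with Vec.splitAt r X
    ... | P , Q , refl rewrite ∣p++q∣≡∣p∣+∣q∣ P Q = ≰⇒> λ small →
      P-empty small (∈-++⁻ˡ a₀ (maximal N[a₀] N[a₀]-mutualVisibility (⊆N[a₀] small) a₀∈N[a₀]))
      where
      Q-full : ∣ P ∣ + ∣ Q ∣ ≤ s → ∀ k → k ∈ Q
      Q-full small k = ∈-++⁻ʳ P (maximal _ (∣P∣+∣Q∣≤s⇒mutualVisibility-∪⁅k⁆ P Q k small)
                                         (++-mono-⊆ {p = P} (λ j∈P → j∈P) (p⊆p∪q ⁅ k ⁆))
                                         (∈-++⁺ʳ P (q⊆p∪q Q ⁅ k ⁆ (x∈⁅x⁆ k))))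
      P-empty : ∣ P ∣ + ∣ Q ∣ ≤ s → ∀ {j} → j ∉ P
      P-empty small j∈P = <⇒≱ (+-mono-≤ (x∈p⇒1≤∣p∣ j∈P) (∀∈⇒n≤∣p∣ (Q-full small))) small
      ⊆N[a₀] : ∣ P ∣ + ∣ Q ∣ ≤ s → P ++ Q ⊆ N[a₀]
      ⊆N[a₀] small = ++-mono-⊆ (λ j∈P → ⊥-elim (P-empty small j∈P)) (λ _ → ∈⊤)

    μ⁻ : MuMinusIs (K r s) (suc s)
    μ⁻ = (N[a₀] , (N[a₀]-mutualVisibility , N[a₀]-maximal) , ∣N[a₀]∣≡1+s) , μ-lowerBound

    ⁅a₀,b₀⁆ : Subset (r + s)
    ⁅a₀,b₀⁆ = ⁅ a₀ ⁆ ++ ⁅ b₀ ⁆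

    a₀∈⁅a₀,b₀⁆ : A a₀ ∈ ⁅a₀,b₀⁆
    a₀∈⁅a₀,b₀⁆ = ∈-++⁺ˡ (x∈⁅x⁆ a₀)

    b₀∈⁅a₀,b₀⁆ : B b₀ ∈ ⁅a₀,b₀⁆
    b₀∈⁅a₀,b₀⁆ = ∈-++⁺ʳ ⁅ a₀ ⁆ (x∈⁅x⁆ b₀)

    ∣⁅a₀,b₀⁆∣≡2 : ∣ ⁅a₀,b₀⁆ ∣ ≡ 2
    ∣⁅a₀,b₀⁆∣≡2 = trans (∣p++q∣≡∣p∣+∣q∣ ⁅ a₀ ⁆ ⁅ b₀ ⁆) (cong₂ _+_ (∣⁅x⁆∣≡1 a₀) (∣⁅x⁆∣≡1 b₀))

    ⁅a₀,b₀⁆-maximal : ∀ Y → IsGeneralPosition (K r s) Y → ⁅a₀,b₀⁆ ⊆ Y → Y ⊆ ⁅a₀,b₀⁆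
    ⁅a₀,b₀⁆-maximal Y Y-general ⊆Y {y} y∈Y with split r y
    ... | inˡ j with j ≟ a₀
    ...   | yes refl = a₀∈⁅a₀,b₀⁆
    ...   | no j≢a₀  = ⊥-elim (twoStep⇒¬generalPosition (K r s) Y (j≢a₀ ∘ A-injective)
                                 ¬A-adj-A A-adj-B B-adj-A (≢-sym A≢B) (≢-sym A≢B)
                                 y∈Y (⊆Y a₀∈⁅a₀,b₀⁆) (⊆Y b₀∈⁅a₀,b₀⁆) Y-general)
    ⁅a₀,b₀⁆-maximal Y Y-general ⊆Y {y} y∈Y | inʳ k with k ≟ b₀
    ...   | yes refl = b₀∈⁅a₀,b₀⁆
    ...   | no k≢b₀  = ⊥-elim (twoStep⇒¬generalPosition (K r s) Y (k≢b₀ ∘ B-injective)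
                                 ¬B-adj-B B-adj-A A-adj-B A≢B A≢B
                                 y∈Y (⊆Y b₀∈⁅a₀,b₀⁆) (⊆Y a₀∈⁅a₀,b₀⁆) Y-general)

    gp⁻ : GpMinusIs (K r s) 2
    gp⁻ = (⁅a₀,b₀⁆ , ( ∣X∣≤2⇒generalPosition (K r s) ⁅a₀,b₀⁆ (≤-reflexive ∣⁅a₀,b₀⁆∣≡2)
                     , ⁅a₀,b₀⁆-maximal) , ∣⁅a₀,b₀⁆∣≡2)
        , maximalGeneralPosition⇒2≤∣X∣ (K r s) (+-mono-≤ (≤-trans 1≤s s≤r) 1≤s)

proposition2p6 : ∀ (r s : ℕ) → 1 ≤ s → s ≤ r →
    MuMinusIs (K r s) (suc s) × GpMinusIs (K r s) 2
proposition2p6 r s 1≤s s≤r = μ⁻ 1≤s s≤r , gp⁻ 1≤s s≤r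
  where open CompleteBipartite r s
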